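{- Let $q=p^r$ with $p$ prime, $k\geqslant 2$, and let $0\leqslant j\leqslant q-2$ be such that $C_j=\{c_j,c_{j+(q-1)}\}$ has exactly two elements, with associated $2\times 2$ matrix $M_j$. If $M_j\neq 0$, then $M_j$ is diagonalizable over $\mathbb{C}_\infty$ if and only if either (1) $\binom{k-2-j}{j}\neq 0$ in $\mathbb{F}_p$, or (2) $q$ is odd and $\det(M_j)\neq 0$.
   Context: Let $A=\mathbb{F}_q[t]$, $\mathbb{C}_\infty$ the completion of an algebraic closure of $\mathbb{F}_q((1/t))$. Let $\Gamma_1(t)=\{\gamma\in GL_2(A):\gamma\equiv\left(\begin{smallmatrix}1&*\\0&1\end{smallmatrix}\right)\pmod t\}$ and $S^1_k(\Gamma_1(t))$ the $\mathbb{C}_\infty$-space of Drinfeld cusp forms of weight $k$ for $\Gamma_1(t)$ on the Drinfeld upper half plane, with Atkin operator $U_t(f)(z)=\sum_{\beta\in\mathbb{F}_q}f\big(\frac{z+\beta}{t}\big)$ (up to a nonzero normalizing scalar). Via Teitelbaum's isomorphism with harmonic cocycles, $S^1_k(\Gamma_1(t))$ has a basis $c_0,\dots,c_{k-2}$ on which $$U_t(c_j)=-(-t)^{j+1}\binom{k-2-j}{j}c_j-t^{j+1}\sum_{h\neq 0}\left[\binom{k-2-j-h(q-1)}{ -h(q-1)}+(-1)^{j+1}\binom{k-2-j-h(q-1)}{j}\right]c_{j+h(q-1)},$$ with $c_i=0$ for $i\notin[0,k-2]$, binomial coefficients reduced into $\mathbb{F}_p\subset\mathbb{C}_\infty$ and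 $\binom{n}{m}=0$ if $m<0$ or $m>n$. For $0\leqslant j\leqslant q-2$, $C_j=\{c_\ell:0\leqslant\ell\leqslant k-2,\ \ell\equiv j\pmod{q-1}\}$; its span is $U_t$-stable and $M_j$ is the matrix of $U_t$ on it in the basis $C_j$ ordered by increasing index. -}

module Defs where

open import Level using (Level; _⊔_)
open import Algebra.Bundles using (CommutativeRing)
open import Data.Nat as ℕ using (ℕ; zero; suc)
open import Data.Nat.Combinatorics using (_C_)
open import Data.Nat.Divisibility using (_∣_)
open import Data.Integer as ℤ using (ℤ; +_; -[1+_])
open import Data.Fin using (Fin; zero; suc)
open import Data.List using (List; []; _∷_)
open import Data.List.Relation.Unary.Any using (Any)
open import Data.Vec using (Vec; lookup)
open import Data.Product using (Σ; ∃; _×_)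
open import Relation.Nullary using (¬_)

-- Binomial coefficient on integers with the paper's convention:
-- binom n m = 0 if m < 0 or m > n (in particular if n < 0 ≤ m).
binomℤ : ℤ → ℤ → ℕ
binomℤ n -[1+ m ] = 0
binomℤ -[1+ n ] (+ m) = 0
binomℤ (+ n) (+ m) = n C m

module _ {c ℓ : Level} (K : CommutativeRing c ℓ) where
  open CommutativeRing K using (Carrier; _≈_; _+_; _*_; -_; _-_; 0#; 1#)

  -- n ↦ n·1 : ℕ → K (factors through 𝔽_p when char K = p)
  ι : ℕ → Carrier
  ι zero = 0#
  ι (suc n) = 1# + ι n

  pow : Carrier → ℕ → Carrier
  pow x zero = 1#
  pow x (suc n) = x * pow x n

  evalPoly : List Carrier → Carrier → Carrier
  evalPoly [] x = 0#
  evalPoly (a ∷ as) x = a + x * evalPoly as x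

  IsField : Set (c ⊔ ℓ)
  IsField = (¬ (1# ≈ 0#)) × (∀ x → ¬ (x ≈ 0#) → ∃ λ y → x * y ≈ 1#)

  AlgClosed : Set (c ⊔ ℓ)
  AlgClosed = ∀ (n : ℕ) (a : Vec Carrier (suc n)) →
    ∃ λ x → pow x (suc n) + evalPoly (Data.Vec.toList a) x ≈ 0#

  -- t is transcendental over 𝔽_p: no polynomial with coefficients in 𝔽_p
  -- (given by natural-number representatives, not all divisible by p) vanishes at t
  TranscendentalOverFp : ℕ → Carrier → Set ℓ
  TranscendentalOverFp p t = ∀ (cs : List ℕ) → Any (λ a → ¬ (p ∣ a)) cs →
    ¬ (evalPoly (Data.List.map ι cs) t ≈ 0#)

  Mat2 : Set c
  Mat2 = Fin 2 → Fin 2 → Carrier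

  _·_ : Mat2 → Mat2 → Mat2
  (A · B) i j = A i zero * B zero j + A i (suc zero) * B (suc zero) j

  I₂ : Mat2
  I₂ zero zero = 1#
  I₂ zero (suc _) = 0#
  I₂ (suc _) zero = 0#
  I₂ (suc zero) (suc zero) = 1#

  _≈M_ : Mat2 → Mat2 → Set ℓ
  A ≈M B = ∀ i j → A i j ≈ B i j

  IsDiagonal : Mat2 → Set ℓ
  IsDiagonal D = (D zero (suc zero) ≈ 0#) × (D (suc zero) zero ≈ 0#)

  Diagonalizable : Mat2 → Set (c ⊔ ℓ)
  Diagonalizable M = Σ Mat2 λ P → Σ Mat2 λ Q →
    ((P · Q) ≈M I₂) × ((Q · P) ≈M I₂) × IsDiagonal ((Q · M) · P)

  det : Mat2 → Carrier
  det M = M zero zero * M (suc zero) (suc zero) - M zero (suc zero) * M (suc zero) zero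

  -- Coefficients of U_t(c_ℓ) from the formula, with parameters q, k and t ∈ K.
  -- diagonal coefficient: -(-t)^{ℓ+1} binom(k-2-ℓ, ℓ)
  diagCoef : (q k : ℕ) → Carrier → ℕ → Carrier
  diagCoef q k t l =
    - (pow (- t) (suc l) * ι (binomℤ ((+ k ℤ.- + 2) ℤ.- + l) (+ l)))

  -- coefficient of c_{ℓ+h(q-1)} (h ≠ 0):
  -- -t^{ℓ+1} [ binom(k-2-ℓ-h(q-1), -h(q-1)) + (-1)^{ℓ+1} binom(k-2-ℓ-h(q-1), ℓ) ]
  offCoef : (q k : ℕ) → Carrier → ℕ → ℤ → Carrier
  offCoef q k t l h =
    - (pow t (suc l) *
       (ι (binomℤ N (ℤ.- (h ℤ.* (+ q ℤ.- + 1))))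
        + pow (- 1#) (suc l) * ι (binomℤ N (+ l))))
    where
    N : ℤ
    N = ((+ k ℤ.- + 2) ℤ.- + l) ℤ.- h ℤ.* (+ q ℤ.- + 1)

  -- M_j when C_j = {c_j, c_{j+(q-1)}}: matrix of U_t in the ordered basis
  -- (c_j, c_{j+(q-1)}); column s holds the coordinates of U_t of the s-th basis vector.
  Mj : (q k : ℕ) → Carrier → ℕ → Mat2
  Mj q k t j zero zero = diagCoef q k t j
  Mj q k t j (suc zero) zero = offCoef q k t j (+ 1)
  Mj q k t j zero (suc zero) = offCoef q k t (j ℕ.+ (q ℕ.∸ 1)) (ℤ.- + 1)
  Mj q k t j (suc zero) (suc zero) = diagCoef q k t (j ℕ.+ (q ℕ.∸ 1))

module Submission where

-- The proof separates general linear algebra from the computation of M_j.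
--  * Diagonalization: over an algebraically closed field, a nonzero matrix with
--    zero diagonal is diagonalizable iff det M ≠ 0 and 2 ≠ 0 (its square is
--    -det(M)·I), and a matrix whose characteristic polynomial has nonzero
--    discriminant is diagonalizable (explicit eigenvector bases).
--  * CoefficientsOfMj: δ = 0 because binom(k-2-b, b) = 0 for b = j+q-1;
--    α = ±t^(j+1)·B₀; β, γ are powers of t times images of natural numbers.
--    Hence α = 0 iff p ∣ B₀, and if p ∤ B₀ the discriminant
--    α² + 4βγ = t^(2j+2)(B₀² + κ t^(q-1)) is nonzero since t is transcendental.
--  * Characteristic: q is even iff p = 2 iff 2 = 0 in K.
-- The theorem splits on p ∣ B₀: if p ∤ B₀ both sides hold; if p ∣ B₀ the matrix
-- has zero diagonal and the zero-diagonal criterion is exactly the right side.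

open import Level using (Level)
open import Algebra.Bundles using (CommutativeRing)
open import Data.Nat as ℕ using (ℕ; zero; suc; _∸_; _^_; _≤_; _<_; s≤s; z≤n)
import Data.Nat.Properties as ℕP
open import Data.Nat.Combinatorics using (_C_; k>n⇒nCk≡0)
open import Data.Nat.Divisibility using (_∣_; _∣?_; divides; ∣-refl; ∣1⇒≡1; m∣m*n)
open import Data.Nat.Primality
  using (Prime; ¬prime[1]; prime[2]; euclidsLemma; irreducible[2]; prime⇒irreducible; prime⇒nonZero)
open import Data.Integer as ℤ using (ℤ; +_; -[1+_])
import Data.Integer.Properties as ℤP
open import Data.Sign as Sign using (Sign)
open import Data.Maybe using (Maybe; just; nothing)
open import Data.Fin using (Fin; zero; suc)
open import Data.List using ([]; _∷_; replicate; _++_)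
import Data.List as List
open import Data.List.Relation.Unary.Any using (here; there)
open import Data.Vec using ([]; _∷_)
open import Data.Product using (∃; _×_; _,_; proj₁; proj₂)
open import Data.Sum using (_⊎_; inj₁; inj₂)
open import Data.Empty using (⊥; ⊥-elim)
open import Relation.Nullary using (¬_; yes; no)
open import Relation.Binary.Bundles using (Setoid)
import Relation.Binary.Reasoning.Setoid
open import Relation.Binary.PropositionalEquality as ≡ using (_≡_)
open import Function.Base using (_∘_)
open import Function.Bundles using (_⇔_; mk⇔; Equivalence)
open import Defs

-- The integer-coefficient ring solver for an arbitrary commutative ring K:
-- the coefficient embedding ⌜_⌝ : ℤ → K is a ring homomorphism, so every
-- identity between polynomial expressions with integer constants holds in K.
module IntegerCoefficients {c ℓ : Level} (K : CommutativeRing c ℓ) where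
  open CommutativeRing K
  open import Algebra.Properties.Ring ring using (-1*x≈-x)
  open import Algebra.Properties.AbelianGroup +-abelianGroup
    using (ε⁻¹≈ε; ⁻¹-involutive; ⁻¹-∙-comm)
  open import Algebra.Properties.CommutativeSemigroup +-commutativeSemigroup
    using () renaming (interchange to +-interchange)
  open import Algebra.Properties.CommutativeSemigroup *-commutativeSemigroup
    using () renaming (interchange to *-interchange)
  open import Algebra.Properties.Semiring.Mult.TCOptimised semiring
    using (1+×; ×-homo-+; ×1-homo-*) renaming (_×_ to _×′_)
  open import Algebra.Solver.Ring.AlmostCommutativeRing
    using (fromCommutativeRing; _-Raw-AlmostCommutative⟶_)
  open import Relation.Binary.Reasoning.Setoid setoid

  -- n ↦ n·1, with 1·1 computing to 1# so that constants in solver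
  -- equations match the way they are written in goals
  nat : ℕ → Carrier
  nat n = n ×′ 1#

  ⌜_⌝ : ℤ → Carrier
  ⌜ + n ⌝ = nat n
  ⌜ -[1+ n ] ⌝ = - nat (suc n)

  private
    cancel-left : ∀ x y z → (x + y) - (x + z) ≈ y - z
    cancel-left x y z = begin
      (x + y) + - (x + z)    ≈⟨ +-congˡ (⁻¹-∙-comm x z) ⟨
      (x + y) + (- x + - z)  ≈⟨ +-interchange x y (- x) (- z) ⟩
      (x - x) + (y - z)      ≈⟨ +-congʳ (-‿inverseʳ x) ⟩
      0# + (y - z)           ≈⟨ +-identityˡ (y - z) ⟩
      y - z                  ∎

    ⊖-homo : ∀ m n → ⌜ m ℤ.⊖ n ⌝ ≈ nat m - nat n
    ⊖-homo m zero = sym (trans (+-congˡ ε⁻¹≈ε) (+-identityʳ (nat m)))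
    ⊖-homo zero (suc n) = sym (+-identityˡ _)
    ⊖-homo (suc m) (suc n) = begin
      ⌜ suc m ℤ.⊖ suc n ⌝               ≡⟨ ≡.cong ⌜_⌝ (ℤP.[1+m]⊖[1+n]≡m⊖n m n) ⟩
      ⌜ m ℤ.⊖ n ⌝                        ≈⟨ ⊖-homo m n ⟩
      nat m - nat n                      ≈⟨ cancel-left 1# (nat m) (nat n) ⟨
      (1# + nat m) - (1# + nat n)        ≈⟨ +-cong (1+× m 1#) (-‿cong (1+× n 1#)) ⟨
      nat (suc m) - nat (suc n)          ∎

    +-homo : ∀ i j → ⌜ i ℤ.+ j ⌝ ≈ ⌜ i ⌝ + ⌜ j ⌝
    +-homo (+ m) (+ n) = ×-homo-+ 1# m n
    +-homo (+ m) -[1+ n ] = ⊖-homo m (suc n)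
    +-homo -[1+ m ] (+ n) = trans (⊖-homo n (suc m)) (+-comm _ _)
    +-homo -[1+ m ] -[1+ n ] = begin
      - nat (suc (suc (m ℕ.+ n)))         ≡⟨ ≡.cong (λ x → - nat (suc x)) (ℕP.+-suc m n) ⟨
      - nat (suc m ℕ.+ suc n)             ≈⟨ -‿cong (×-homo-+ 1# (suc m) (suc n)) ⟩
      - (nat (suc m) + nat (suc n))       ≈⟨ ⁻¹-∙-comm _ _ ⟨
      - nat (suc m) + - nat (suc n)       ∎

    neg-homo : ∀ i → ⌜ ℤ.- i ⌝ ≈ - ⌜ i ⌝
    neg-homo (+ zero) = sym ε⁻¹≈ε
    neg-homo (+ suc n) = refl
    neg-homo -[1+ n ] = sym (⁻¹-involutive _)

    -- multiplication is handled through the decomposition i = sign i ◃ ∣ i ∣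
    ⌜_⌝ₛ : Sign → Carrier
    ⌜ Sign.+ ⌝ₛ = 1#
    ⌜ Sign.- ⌝ₛ = - 1#

    ◃-homo : ∀ s n → ⌜ s ℤ.◃ n ⌝ ≈ ⌜ s ⌝ₛ * nat n
    ◃-homo s zero = sym (zeroʳ _)
    ◃-homo Sign.+ (suc n) = sym (*-identityˡ _)
    ◃-homo Sign.- (suc n) = sym (-1*x≈-x _)

    sign-abs : ∀ i → ⌜ i ⌝ ≈ ⌜ ℤ.sign i ⌝ₛ * nat ℤ.∣ i ∣
    sign-abs i = trans (reflexive (≡.cong ⌜_⌝ (≡.sym (ℤP.◃-inverse i)))) (◃-homo (ℤ.sign i) ℤ.∣ i ∣)

    sign-*-homo : ∀ s t → ⌜ s Sign.* t ⌝ₛ ≈ ⌜ s ⌝ₛ * ⌜ t ⌝ₛ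
    sign-*-homo Sign.+ Sign.+ = sym (*-identityˡ _)
    sign-*-homo Sign.+ Sign.- = sym (*-identityˡ _)
    sign-*-homo Sign.- Sign.+ = sym (*-identityʳ _)
    sign-*-homo Sign.- Sign.- = sym (trans (-1*x≈-x _) (⁻¹-involutive _))

    *-homo : ∀ i j → ⌜ i ℤ.* j ⌝ ≈ ⌜ i ⌝ * ⌜ j ⌝
    *-homo i j = begin
      ⌜ s ℤ.◃ ℤ.∣ i ∣ ℕ.* ℤ.∣ j ∣ ⌝                 ≈⟨ ◃-homo s (ℤ.∣ i ∣ ℕ.* ℤ.∣ j ∣) ⟩
      ⌜ s ⌝ₛ * nat (ℤ.∣ i ∣ ℕ.* ℤ.∣ j ∣)
        ≈⟨ *-cong (sign-*-homo (ℤ.sign i) (ℤ.sign j)) (×1-homo-* ℤ.∣ i ∣ ℤ.∣ j ∣) ⟩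
      (⌜ ℤ.sign i ⌝ₛ * ⌜ ℤ.sign j ⌝ₛ) * (nat ℤ.∣ i ∣ * nat ℤ.∣ j ∣) ≈⟨ *-interchange _ _ _ _ ⟩
      (⌜ ℤ.sign i ⌝ₛ * nat ℤ.∣ i ∣) * (⌜ ℤ.sign j ⌝ₛ * nat ℤ.∣ j ∣) ≈⟨ *-cong (sign-abs i) (sign-abs j) ⟨
      ⌜ i ⌝ * ⌜ j ⌝                                   ∎
      where s = ℤ.sign i Sign.* ℤ.sign j

    homomorphism : ℤ.+-*-rawRing -Raw-AlmostCommutative⟶ fromCommutativeRing K
    homomorphism = record
      { ⟦_⟧ = ⌜_⌝ ; +-homo = +-homo ; *-homo = *-homo ; -‿homo = neg-homo
      ; 0-homo = refl ; 1-homo = refl }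

    coefficients≟ : ∀ i j → Maybe (⌜ i ⌝ ≈ ⌜ j ⌝)
    coefficients≟ i j with i ℤ.≟ j
    ... | yes ≡.refl = just refl
    ... | no _ = nothing

  open import Algebra.Solver.Ring ℤ.+-*-rawRing (fromCommutativeRing K) homomorphism coefficients≟ public
    using (Polynomial; solve; _:=_; _:+_; _:*_; _:-_; :-_; con)

  lit : ∀ {m} → ℕ → Polynomial m
  lit n = con (+ n)

module Matrices {c ℓ : Level} (K : CommutativeRing c ℓ) where
  open CommutativeRing K hiding (zero)
  open IntegerCoefficients K
  module ≈-Reasoning = Relation.Binary.Reasoning.Setoid setoid

  ₀ ₁ : Fin 2
  ₀ = zero
  ₁ = suc zero

  infixl 7 _⊙_
  infixr 8 _⋆_
  infix 4 _≋_

  _⊙_ : Mat2 K → Mat2 K → Mat2 K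
  _⊙_ = _·_ K

  _≋_ : Mat2 K → Mat2 K → Set ℓ
  _≋_ = _≈M_ K

  I : Mat2 K
  I = I₂ K

  _⋆_ : Carrier → Mat2 K → Mat2 K
  (x ⋆ A) i j = x * A i j

  mk : Carrier → Carrier → Carrier → Carrier → Mat2 K
  mk a b c d zero zero = a
  mk a b c d zero (suc zero) = b
  mk a b c d (suc zero) zero = c
  mk a b c d (suc zero) (suc zero) = d

  diagonal : Carrier → Carrier → Mat2 K
  diagonal a d = mk a 0# 0# d

  adj : Mat2 K → Mat2 K
  adj A = mk (A ₁ ₁) (- A ₀ ₁) (- A ₁ ₀) (A ₀ ₀)

  trace : Mat2 K → Carrier
  trace A = A ₀ ₀ + A ₁ ₁

  conj : Mat2 K → Mat2 K → Mat2 K → Mat2 K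
  conj Q P A = (Q ⊙ A) ⊙ P

  matrixSetoid : Setoid c ℓ
  matrixSetoid = record
    { Carrier = Mat2 K
    ; _≈_ = _≋_
    ; isEquivalence = record
      { refl = λ i j → refl
      ; sym = λ A≋B i j → sym (A≋B i j)
      ; trans = λ A≋B B≋C i j → trans (A≋B i j) (B≋C i j)
      }
    }

  open Setoid matrixSetoid public using () renaming (refl to ≋-refl; sym to ≋-sym)
  module ≋-Reasoning = Relation.Binary.Reasoning.Setoid matrixSetoid

  ⊙-cong : ∀ {A A′ B B′} → A ≋ A′ → B ≋ B′ → A ⊙ B ≋ A′ ⊙ B′
  ⊙-cong A≋A′ B≋B′ i j =
    +-cong (*-cong (A≋A′ i ₀) (B≋B′ ₀ j)) (*-cong (A≋A′ i ₁) (B≋B′ ₁ j))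

  ⋆-cong : ∀ x {A B} → A ≋ B → x ⋆ A ≋ x ⋆ B
  ⋆-cong x A≋B i j = *-congˡ (A≋B i j)

  ⊙-assoc : ∀ A B C → (A ⊙ B) ⊙ C ≋ A ⊙ (B ⊙ C)
  ⊙-assoc A B C i j = solve 8
    (λ a₀ a₁ b₀₀ b₀₁ b₁₀ b₁₁ c₀ c₁ →
      (a₀ :* b₀₀ :+ a₁ :* b₁₀) :* c₀ :+ (a₀ :* b₀₁ :+ a₁ :* b₁₁) :* c₁
      := a₀ :* (b₀₀ :* c₀ :+ b₀₁ :* c₁) :+ a₁ :* (b₁₀ :* c₀ :+ b₁₁ :* c₁))
    refl (A i ₀) (A i ₁) (B ₀ ₀) (B ₀ ₁) (B ₁ ₀) (B ₁ ₁) (C ₀ j) (C ₁ j)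

  ⊙-identityˡ : ∀ A → I ⊙ A ≋ A
  ⊙-identityˡ A zero j =
    solve 2 (λ a b → lit 1 :* a :+ lit 0 :* b := a) refl (A ₀ j) (A ₁ j)
  ⊙-identityˡ A (suc zero) j =
    solve 2 (λ a b → lit 0 :* a :+ lit 1 :* b := b) refl (A ₀ j) (A ₁ j)

  ⊙-identityʳ : ∀ A → A ⊙ I ≋ A
  ⊙-identityʳ A i zero =
    solve 2 (λ a b → a :* lit 1 :+ b :* lit 0 := a) refl (A i ₀) (A i ₁)
  ⊙-identityʳ A i (suc zero) =
    solve 2 (λ a b → a :* lit 0 :+ b :* lit 1 := b) refl (A i ₀) (A i ₁)

  ⋆-⊙ : ∀ x A B → (x ⋆ A) ⊙ B ≋ x ⋆ (A ⊙ B)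
  ⋆-⊙ x A B i j = solve 5 (λ x a₀ a₁ b₀ b₁ → x :* a₀ :* b₀ :+ x :* a₁ :* b₁ := x :* (a₀ :* b₀ :+ a₁ :* b₁))
    refl x (A i ₀) (A i ₁) (B ₀ j) (B ₁ j)

  ⊙-⋆ : ∀ x A B → A ⊙ (x ⋆ B) ≋ x ⋆ (A ⊙ B)
  ⊙-⋆ x A B i j = solve 5 (λ x a₀ a₁ b₀ b₁ → a₀ :* (x :* b₀) :+ a₁ :* (x :* b₁) := x :* (a₀ :* b₀ :+ a₁ :* b₁))
    refl x (A i ₀) (A i ₁) (B ₀ j) (B ₁ j)

  ⊙-adj : ∀ A → A ⊙ adj A ≋ det K A ⋆ I
  ⊙-adj A zero zero = solve 4 (λ a b c d → a :* d :+ b :* (:- c) := (a :* d :- b :* c) :* lit 1)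
    refl (A ₀ ₀) (A ₀ ₁) (A ₁ ₀) (A ₁ ₁)
  ⊙-adj A zero (suc zero) = solve 4 (λ a b c d → a :* (:- b) :+ b :* a := (a :* d :- b :* c) :* lit 0)
    refl (A ₀ ₀) (A ₀ ₁) (A ₁ ₀) (A ₁ ₁)
  ⊙-adj A (suc zero) zero = solve 4 (λ a b c d → c :* d :+ d :* (:- c) := (a :* d :- b :* c) :* lit 0)
    refl (A ₀ ₀) (A ₀ ₁) (A ₁ ₀) (A ₁ ₁)
  ⊙-adj A (suc zero) (suc zero) = solve 4 (λ a b c d → c :* (:- b) :+ d :* a := (a :* d :- b :* c) :* lit 1)
    refl (A ₀ ₀) (A ₀ ₁) (A ₁ ₀) (A ₁ ₁)

  adj-⊙ : ∀ A → adj A ⊙ A ≋ det K A ⋆ I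
  adj-⊙ A zero zero = solve 4 (λ a b c d → d :* a :+ (:- b) :* c := (a :* d :- b :* c) :* lit 1)
    refl (A ₀ ₀) (A ₀ ₁) (A ₁ ₀) (A ₁ ₁)
  adj-⊙ A zero (suc zero) = solve 4 (λ a b c d → d :* b :+ (:- b) :* d := (a :* d :- b :* c) :* lit 0)
    refl (A ₀ ₀) (A ₀ ₁) (A ₁ ₀) (A ₁ ₁)
  adj-⊙ A (suc zero) zero = solve 4 (λ a b c d → (:- c) :* a :+ a :* c := (a :* d :- b :* c) :* lit 0)
    refl (A ₀ ₀) (A ₀ ₁) (A ₁ ₀) (A ₁ ₁)
  adj-⊙ A (suc zero) (suc zero) = solve 4 (λ a b c d → (:- c) :* b :+ a :* d := (a :* d :- b :* c) :* lit 1)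
    refl (A ₀ ₀) (A ₀ ₁) (A ₁ ₀) (A ₁ ₁)

  adj-inverse : ∀ A z → det K A * z ≈ 1# → (A ⊙ (z ⋆ adj A) ≋ I) × ((z ⋆ adj A) ⊙ A ≋ I)
  adj-inverse A z dz≈1 =
      (λ i j → trans (⊙-⋆ z A (adj A) i j) (rescale (⊙-adj A i j)))
    , (λ i j → trans (⋆-⊙ z (adj A) A i j) (rescale (adj-⊙ A i j)))
    where
    rescale : ∀ {x e} → x ≈ det K A * e → z * x ≈ e
    rescale {x} {e} x≈de = begin
      z * x               ≈⟨ *-congˡ x≈de ⟩
      z * (det K A * e)   ≈⟨ solve 3 (λ z d e → z :* (d :* e) := (d :* z) :* e) refl z (det K A) e ⟩
      (det K A * z) * e   ≈⟨ *-congʳ dz≈1 ⟩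
      1# * e              ≈⟨ *-identityˡ e ⟩
      e                   ∎
      where open ≈-Reasoning

  conj-cong : ∀ Q P {A B} → A ≋ B → conj Q P A ≋ conj Q P B
  conj-cong Q P A≋B = ⊙-cong (⊙-cong (≋-refl {Q}) A≋B) (≋-refl {P})

  conj-⊙ : ∀ Q P → P ⊙ Q ≋ I → ∀ A B → conj Q P A ⊙ conj Q P B ≋ conj Q P (A ⊙ B)
  conj-⊙ Q P PQ≋I A B = begin
    ((Q ⊙ A) ⊙ P) ⊙ ((Q ⊙ B) ⊙ P)   ≈⟨ ⊙-assoc (Q ⊙ A) P ((Q ⊙ B) ⊙ P) ⟩
    (Q ⊙ A) ⊙ (P ⊙ ((Q ⊙ B) ⊙ P))   ≈⟨ ⊙-cong (≋-refl {Q ⊙ A}) (≋-sym (⊙-assoc P (Q ⊙ B) P)) ⟩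
    (Q ⊙ A) ⊙ ((P ⊙ (Q ⊙ B)) ⊙ P)   ≈⟨ ⊙-cong (≋-refl {Q ⊙ A}) (⊙-cong (≋-sym (⊙-assoc P Q B)) (≋-refl {P})) ⟩
    (Q ⊙ A) ⊙ (((P ⊙ Q) ⊙ B) ⊙ P)   ≈⟨ ⊙-cong (≋-refl {Q ⊙ A}) (⊙-cong (⊙-cong PQ≋I (≋-refl {B})) (≋-refl {P})) ⟩
    (Q ⊙ A) ⊙ ((I ⊙ B) ⊙ P)         ≈⟨ ⊙-cong (≋-refl {Q ⊙ A}) (⊙-cong (⊙-identityˡ B) (≋-refl {P})) ⟩
    (Q ⊙ A) ⊙ (B ⊙ P)               ≈⟨ ≋-sym (⊙-assoc (Q ⊙ A) B P) ⟩
    ((Q ⊙ A) ⊙ B) ⊙ P               ≈⟨ ⊙-cong (⊙-assoc Q A B) (≋-refl {P}) ⟩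
    (Q ⊙ (A ⊙ B)) ⊙ P               ∎
    where open ≋-Reasoning

  conj-inverse : ∀ Q P → P ⊙ Q ≋ I → ∀ A → conj P Q (conj Q P A) ≋ A
  conj-inverse Q P PQ≋I A = begin
    (P ⊙ ((Q ⊙ A) ⊙ P)) ⊙ Q   ≈⟨ ⊙-cong (≋-sym (⊙-assoc P (Q ⊙ A) P)) (≋-refl {Q}) ⟩
    ((P ⊙ (Q ⊙ A)) ⊙ P) ⊙ Q   ≈⟨ ⊙-assoc (P ⊙ (Q ⊙ A)) P Q ⟩
    (P ⊙ (Q ⊙ A)) ⊙ (P ⊙ Q)   ≈⟨ ⊙-cong (≋-sym (⊙-assoc P Q A)) PQ≋I ⟩
    ((P ⊙ Q) ⊙ A) ⊙ I         ≈⟨ ⊙-identityʳ ((P ⊙ Q) ⊙ A) ⟩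
    (P ⊙ Q) ⊙ A               ≈⟨ ⊙-cong PQ≋I (≋-refl {A}) ⟩
    I ⊙ A                     ≈⟨ ⊙-identityˡ A ⟩
    A                         ∎
    where open ≋-Reasoning

  conj-scalar : ∀ Q P x → conj Q P (x ⋆ I) ≋ x ⋆ (Q ⊙ P)
  conj-scalar Q P x = begin
    (Q ⊙ (x ⋆ I)) ⊙ P   ≈⟨ ⊙-cong (⊙-⋆ x Q I) (≋-refl {P}) ⟩
    (x ⋆ (Q ⊙ I)) ⊙ P   ≈⟨ ⋆-⊙ x (Q ⊙ I) P ⟩
    x ⋆ ((Q ⊙ I) ⊙ P)   ≈⟨ ⋆-cong x (⊙-cong (⊙-identityʳ Q) (≋-refl {P})) ⟩
    x ⋆ (Q ⊙ P)         ∎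
    where open ≋-Reasoning

  trace-cong : ∀ {A B} → A ≋ B → trace A ≈ trace B
  trace-cong A≋B = +-cong (A≋B ₀ ₀) (A≋B ₁ ₁)

  det-cong : ∀ {A B} → A ≋ B → det K A ≈ det K B
  det-cong A≋B = +-cong (*-cong (A≋B ₀ ₀) (A≋B ₁ ₁)) (-‿cong (*-cong (A≋B ₀ ₁) (A≋B ₁ ₀)))

module Powers {c ℓ : Level} (K : CommutativeRing c ℓ) where
  open CommutativeRing K
  open IntegerCoefficients K

  pow-+ : ∀ x m n → pow K x (m ℕ.+ n) ≈ pow K x m * pow K x n
  pow-+ x ℕ.zero n = sym (*-identityˡ _)
  pow-+ x (ℕ.suc m) n = trans (*-congˡ (pow-+ x m n)) (sym (*-assoc _ _ _))

  pow-neg-square : ∀ x m → pow K (- x) m * pow K (- x) m ≈ pow K x m * pow K x m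
  pow-neg-square x ℕ.zero = refl
  pow-neg-square x (ℕ.suc m) = begin
    (- x * pow K (- x) m) * (- x * pow K (- x) m)
      ≈⟨ solve 2 (λ x u → (:- x :* u) :* (:- x :* u) := (x :* x) :* (u :* u)) refl x (pow K (- x) m) ⟩
    (x * x) * (pow K (- x) m * pow K (- x) m)       ≈⟨ *-congˡ (pow-neg-square x m) ⟩
    (x * x) * (pow K x m * pow K x m)
      ≈⟨ solve 2 (λ x u → (x :* x) :* (u :* u) := (x :* u) :* (x :* u)) refl x (pow K x m) ⟩
    (x * pow K x m) * (x * pow K x m)               ∎
    where open import Relation.Binary.Reasoning.Setoid setoid

module FieldArithmetic {c ℓ : Level} (K : CommutativeRing c ℓ) (isField : IsField K) where
  open CommutativeRing K
  open IntegerCoefficients K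
  open import Relation.Binary.Reasoning.Setoid setoid

  *-nonzero : ∀ {x y} → ¬ (x ≈ 0#) → ¬ (y ≈ 0#) → ¬ (x * y ≈ 0#)
  *-nonzero {x} {y} x≉0 y≉0 xy≈0 with proj₂ isField x x≉0
  ... | x⁻¹ , xx⁻¹≈1 = y≉0 (begin
    y               ≈⟨ *-identityˡ y ⟨
    1# * y          ≈⟨ *-congʳ xx⁻¹≈1 ⟨
    (x * x⁻¹) * y   ≈⟨ solve 3 (λ x x⁻¹ y → (x :* x⁻¹) :* y := x⁻¹ :* (x :* y)) refl x x⁻¹ y ⟩
    x⁻¹ * (x * y)   ≈⟨ *-congˡ xy≈0 ⟩
    x⁻¹ * 0#        ≈⟨ zeroʳ x⁻¹ ⟩
    0#              ∎)

  -- without decidable equality, x² = 0 only refutes x ≠ 0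
  square-zero : ∀ {x} → x * x ≈ 0# → ¬ ¬ (x ≈ 0#)
  square-zero xx≈0 x≉0 = *-nonzero x≉0 x≉0 xx≈0

  pow-nonzero : ∀ {x} m → ¬ (x ≈ 0#) → ¬ (pow K x m ≈ 0#)
  pow-nonzero ℕ.zero x≉0 = proj₁ isField
  pow-nonzero (ℕ.suc m) x≉0 = *-nonzero x≉0 (pow-nonzero m x≉0)

module Diagonalization {c ℓ : Level} (K : CommutativeRing c ℓ) (isField : IsField K) where
  open CommutativeRing K hiding (zero)
  open IntegerCoefficients K
  open Matrices K
  open FieldArithmetic K isField
  open import Algebra.Properties.Group +-group using (ε⁻¹≈ε; x∙y⁻¹≈ε⇒x≈y)

  zeroDiagonal-square : ∀ M → M ₀ ₀ ≈ 0# → M ₁ ₁ ≈ 0# → M ⊙ M ≋ (- det K M) ⋆ I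
  zeroDiagonal-square M α≈0 δ≈0 i j = begin
    (M ⊙ M) i j          ≈⟨ ⊙-cong M≋N M≋N i j ⟩
    (N ⊙ N) i j          ≈⟨ square-N i j ⟩
    (- det K N) * I i j  ≈⟨ *-congʳ (-‿cong (det-cong M≋N)) ⟨
    (- det K M) * I i j  ∎
    where
    open ≈-Reasoning
    β γ : Carrier
    β = M ₀ ₁
    γ = M ₁ ₀
    N : Mat2 K
    N = mk 0# β γ 0#
    M≋N : M ≋ N
    M≋N zero zero = α≈0
    M≋N zero (suc zero) = refl
    M≋N (suc zero) zero = refl
    M≋N (suc zero) (suc zero) = δ≈0
    square-N : N ⊙ N ≋ (- det K N) ⋆ I
    square-N zero zero = solve 2 (λ b c → lit 0 :* lit 0 :+ b :* c := (:- (lit 0 :* lit 0 :- b :* c)) :* lit 1) refl β γ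
    square-N zero (suc zero) = solve 2 (λ b c → lit 0 :* b :+ b :* lit 0 := (:- (lit 0 :* lit 0 :- b :* c)) :* lit 0) refl β γ
    square-N (suc zero) zero = solve 2 (λ b c → c :* lit 0 :+ lit 0 :* c := (:- (lit 0 :* lit 0 :- b :* c)) :* lit 0) refl β γ
    square-N (suc zero) (suc zero) = solve 2 (λ b c → c :* b :+ lit 0 :* lit 0 := (:- (lit 0 :* lit 0 :- b :* c)) :* lit 1) refl β γ

  -- A nonzero matrix with zero diagonal can only be diagonalizable when det M ≠ 0
  -- and 2 ≠ 0: a diagonal conjugate D of M satisfies D² = -det(M) I, which forces
  -- its two diagonal entries to agree when det M = 0 or 2 = 0, making M scalar.
  zeroDiagonal-diagonalizable⇒ : ∀ M → M ₀ ₀ ≈ 0# → M ₁ ₁ ≈ 0# → ¬ (∀ a b → M a b ≈ 0#) →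
    Diagonalizable K M → ¬ (det K M ≈ 0#) × ¬ (nat 2 ≈ 0#)
  zeroDiagonal-diagonalizable⇒ M α≈0 δ≈0 M≉0 (P , Q , PQ≋I , QP≋I , D₀₁≈0 , D₁₀≈0) = det≉0 , 2≉0
    where
    D : Mat2 K
    D = conj Q P M
    d₀ d₁ s : Carrier
    d₀ = D ₀ ₀
    d₁ = D ₁ ₁
    s = - det K M

    D²≋sI : D ⊙ D ≋ s ⋆ I
    D²≋sI = begin
      D ⊙ D                ≈⟨ conj-⊙ Q P PQ≋I M M ⟩
      conj Q P (M ⊙ M)     ≈⟨ conj-cong Q P (zeroDiagonal-square M α≈0 δ≈0) ⟩
      conj Q P (s ⋆ I)     ≈⟨ conj-scalar Q P s ⟩
      s ⋆ (Q ⊙ P)          ≈⟨ ⋆-cong s QP≋I ⟩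
      s ⋆ I                ∎
      where open ≋-Reasoning

    d₀²≈s : d₀ * d₀ ≈ s
    d₀²≈s = begin
      d₀ * d₀                   ≈⟨ +-identityʳ _ ⟨
      d₀ * d₀ + 0#              ≈⟨ +-congˡ (trans (*-congʳ D₀₁≈0) (zeroˡ _)) ⟨
      (D ⊙ D) ₀ ₀               ≈⟨ D²≋sI ₀ ₀ ⟩
      s * 1#                    ≈⟨ *-identityʳ s ⟩
      s                         ∎
      where open ≈-Reasoning

    d₁²≈s : d₁ * d₁ ≈ s
    d₁²≈s = begin
      d₁ * d₁                   ≈⟨ +-identityˡ _ ⟨
      0# + d₁ * d₁              ≈⟨ +-congʳ (trans (*-congʳ D₁₀≈0) (zeroˡ _)) ⟨
      (D ⊙ D) ₁ ₁               ≈⟨ D²≋sI ₁ ₁ ⟩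
      s * 1#                    ≈⟨ *-identityʳ s ⟩
      s                         ∎
      where open ≈-Reasoning

    difference-square : nat 2 ≈ 0# → (d₀ - d₁) * (d₀ - d₁) ≈ 0#
    difference-square 2≈0 = begin
      (d₀ - d₁) * (d₀ - d₁)
        ≈⟨ solve 2 (λ x y → (x :- y) :* (x :- y) := (x :* x :- x :* y) :+ (y :* y :- x :* y)) refl d₀ d₁ ⟩
      (d₀ * d₀ - d₀ * d₁) + (d₁ * d₁ - d₀ * d₁) ≈⟨ +-cong (+-congʳ d₀²≈s) (+-congʳ d₁²≈s) ⟩
      (s - d₀ * d₁) + (s - d₀ * d₁)           ≈⟨ solve 1 (λ x → x :+ x := lit 2 :* x) refl (s - d₀ * d₁) ⟩
      nat 2 * (s - d₀ * d₁)                   ≈⟨ trans (*-congʳ 2≈0) (zeroˡ _) ⟩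
      0#                                      ∎
      where open ≈-Reasoning

    -- equal diagonal entries make D, hence M = P D Q, the scalar matrix d₀ I;
    -- as M₀₀ = 0 this means M = 0
    equal-eigenvalues : d₀ ≈ d₁ → ⊥
    equal-eigenvalues d₀≈d₁ = M≉0 (λ a b → trans (M≋d₀I a b) (trans (*-congʳ d₀≈0) (zeroˡ _)))
      where
      D≋d₀I : D ≋ d₀ ⋆ I
      D≋d₀I zero zero = sym (*-identityʳ d₀)
      D≋d₀I zero (suc zero) = trans D₀₁≈0 (sym (zeroʳ d₀))
      D≋d₀I (suc zero) zero = trans D₁₀≈0 (sym (zeroʳ d₀))
      D≋d₀I (suc zero) (suc zero) = trans (sym d₀≈d₁) (sym (*-identityʳ d₀))

      M≋d₀I : M ≋ d₀ ⋆ I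
      M≋d₀I = begin
        M                    ≈⟨ conj-inverse Q P PQ≋I M ⟨
        conj P Q D           ≈⟨ conj-cong P Q D≋d₀I ⟩
        conj P Q (d₀ ⋆ I)    ≈⟨ conj-scalar P Q d₀ ⟩
        d₀ ⋆ (P ⊙ Q)         ≈⟨ ⋆-cong d₀ PQ≋I ⟩
        d₀ ⋆ I               ∎
        where open ≋-Reasoning

      d₀≈0 : d₀ ≈ 0#
      d₀≈0 = trans (sym (*-identityʳ d₀)) (trans (sym (M≋d₀I ₀ ₀)) α≈0)

    -- det M = 0 gives d₀² = d₁² = 0
    det≉0 : ¬ (det K M ≈ 0#)
    det≉0 det≈0 =
      square-zero (trans d₀²≈s s≈0) λ d₀≈0 →
      square-zero (trans d₁²≈s s≈0) λ d₁≈0 →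
      equal-eigenvalues (trans d₀≈0 (sym d₁≈0))
      where
      s≈0 : s ≈ 0#
      s≈0 = trans (-‿cong det≈0) ε⁻¹≈ε

    -- 2 = 0 gives (d₀ - d₁)² = 0
    2≉0 : ¬ (nat 2 ≈ 0#)
    2≉0 2≈0 = square-zero (difference-square 2≈0) λ d₀-d₁≈0 →
      equal-eigenvalues (x∙y⁻¹≈ε⇒x≈y d₀ d₁ d₀-d₁≈0)

  -- discriminant of the characteristic polynomial X² - tr(M) X + det(M)
  discriminant : Mat2 K → Carrier
  discriminant M = trace M * trace M - nat 4 * det K M

  discriminant-cong : ∀ {A B} → A ≋ B → discriminant A ≈ discriminant B
  discriminant-cong A≋B = +-cong (*-cong (trace-cong A≋B) (trace-cong A≋B)) (-‿cong (*-congˡ (det-cong A≋B)))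

  eigenbasis-diagonalizable : ∀ M P x y → ¬ (det K P ≈ 0#) →
    M ⊙ P ≋ P ⊙ diagonal x y → Diagonalizable K M
  eigenbasis-diagonalizable M P x y detP≉0 MP≋PD with proj₂ isField (det K P) detP≉0
  ... | z , detP·z≈1 = P , Q , PQ≋I , QP≋I , QMP≋D ₀ ₁ , QMP≋D ₁ ₀
    where
    Q D : Mat2 K
    Q = z ⋆ adj P
    D = diagonal x y
    PQ≋I : P ⊙ Q ≋ I
    PQ≋I = proj₁ (adj-inverse P z detP·z≈1)
    QP≋I : Q ⊙ P ≋ I
    QP≋I = proj₂ (adj-inverse P z detP·z≈1)
    QMP≋D : conj Q P M ≋ D
    QMP≋D = begin
      (Q ⊙ M) ⊙ P    ≈⟨ ⊙-assoc Q M P ⟩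
      Q ⊙ (M ⊙ P)    ≈⟨ ⊙-cong (≋-refl {Q}) MP≋PD ⟩
      Q ⊙ (P ⊙ D)    ≈⟨ ≋-sym (⊙-assoc Q P D) ⟩
      (Q ⊙ P) ⊙ D    ≈⟨ ⊙-cong QP≋I (≋-refl {D}) ⟩
      I ⊙ D          ≈⟨ ⊙-identityˡ D ⟩
      D              ∎
      where open ≋-Reasoning

  -- an upper triangular matrix with distinct diagonal entries α, δ is diagonalizable,
  -- with eigenvectors (1, 0) and (β, δ - α)
  triangular-diagonalizable : ∀ M → M ₁ ₀ ≈ 0# → ¬ (M ₀ ₀ - M ₁ ₁ ≈ 0#) → Diagonalizable K M
  triangular-diagonalizable M γ≈0 α-δ≉0 = eigenbasis-diagonalizable M P α δ detP≉0 eigenvectors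
    where
    α β γ δ : Carrier
    α = M ₀ ₀
    β = M ₀ ₁
    γ = M ₁ ₀
    δ = M ₁ ₁
    P : Mat2 K
    P = mk 1# β 0# (δ - α)

    detP≉0 : ¬ (det K P ≈ 0#)
    detP≉0 detP≈0 = α-δ≉0 (begin
      α - δ                         ≈⟨ solve 3 (λ a b d → a :- d := :- (lit 1 :* (d :- a) :- b :* lit 0)) refl α β δ ⟩
      - det K P                     ≈⟨ -‿cong detP≈0 ⟩
      - 0#                          ≈⟨ ε⁻¹≈ε ⟩
      0#                            ∎)
      where open ≈-Reasoning

    drop-γ : ∀ {x y} w → x ≈ y + γ * w → x ≈ y
    drop-γ {x} {y} w x≈y+γw = trans x≈y+γw (trans (+-congˡ (trans (*-congʳ γ≈0) (zeroˡ w))) (+-identityʳ y))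

    eigenvectors : M ⊙ P ≋ P ⊙ diagonal α δ
    eigenvectors zero zero = solve 2 (λ a b → a :* lit 1 :+ b :* lit 0 := lit 1 :* a :+ b :* lit 0) refl α β
    eigenvectors zero (suc zero) = solve 3 (λ a b d → a :* b :+ b :* (d :- a) := lit 1 :* lit 0 :+ b :* d) refl α β δ
    eigenvectors (suc zero) zero = drop-γ 1# (solve 3 (λ a c d →
      c :* lit 1 :+ d :* lit 0 := (lit 0 :* a :+ (d :- a) :* lit 0) :+ c :* lit 1) refl α γ δ)
    eigenvectors (suc zero) (suc zero) = drop-γ β (solve 4 (λ a b c d →
      c :* b :+ d :* (d :- a) := (lit 0 :* lit 0 :+ (d :- a) :* d) :+ c :* b) refl α β γ δ)

  -- If M₁₀ = γ ≠ 0 and the characteristic polynomial χ has two distinct roots ρ, ρ′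
  -- (one exists by algebraic closure, ρ′ = tr M - ρ), then (ρ - δ, γ) and (ρ′ - δ, γ)
  -- are independent eigenvectors.
  lowerLeft-diagonalizable : AlgClosed K → ∀ M → ¬ (M ₁ ₀ ≈ 0#) → ¬ (discriminant M ≈ 0#) →
    Diagonalizable K M
  lowerLeft-diagonalizable closed M γ≉0 Δ≉0 with closed 1 (det K M ∷ - trace M ∷ [])
  ... | ρ , χρ≈0 = eigenbasis-diagonalizable M P ρ ρ′ detP≉0 eigenvectors
    where
    α β γ δ ρ′ : Carrier
    α = M ₀ ₀
    β = M ₀ ₁
    γ = M ₁ ₀
    δ = M ₁ ₁
    ρ′ = trace M - ρ
    P : Mat2 K
    P = mk (ρ - δ) (ρ′ - δ) γ γ

    -- χ(ρ), in the form produced by `closed`, and the same expression for the solver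
    χρ : Carrier
    χρ = ρ * (ρ * 1#) + (det K M + ρ * (- trace M + ρ * 0#))

    χ : ∀ {m} → Polynomial m → Polynomial m → Polynomial m → Polynomial m → Polynomial m → Polynomial m
    χ a b c d r = r :* (r :* lit 1) :+ ((a :* d :- b :* c) :+ r :* (:- (a :+ d) :+ r :* lit 0))

    drop-χρ : ∀ {x y} w → x ≈ y + w * χρ → x ≈ y
    drop-χρ {x} {y} w x≈y+wχ = trans x≈y+wχ (trans (+-congˡ (trans (*-congˡ χρ≈0) (zeroʳ w))) (+-identityʳ y))

    gap² : (ρ - ρ′) * (ρ - ρ′) ≈ discriminant M
    gap² = drop-χρ (nat 4) (solve 5 (λ a b c d r →
      (r :- ((a :+ d) :- r)) :* (r :- ((a :+ d) :- r))
      := ((a :+ d) :* (a :+ d) :- lit 4 :* (a :* d :- b :* c))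
         :+ lit 4 :* χ a b c d r) refl α β γ δ ρ)

    detP≉0 : ¬ (det K P ≈ 0#)
    detP≉0 detP≈0 = *-nonzero γ≉0 (λ gap≈0 → Δ≉0 (trans (sym gap²) (trans (*-congʳ gap≈0) (zeroˡ _))))
      (trans (solve 4 (λ c d r r′ → c :* (r :- r′) := (r :- d) :* c :- (r′ :- d) :* c) refl γ δ ρ ρ′) detP≈0)

    eigenvectors : M ⊙ P ≋ P ⊙ diagonal ρ ρ′
    eigenvectors zero zero = drop-χρ (- 1#) (solve 5 (λ a b c d r →
      a :* (r :- d) :+ b :* c
      := ((r :- d) :* r :+ (((a :+ d) :- r) :- d) :* lit 0)
         :+ (:- lit 1) :* χ a b c d r) refl α β γ δ ρ)
    eigenvectors zero (suc zero) = drop-χρ (- 1#) (solve 5 (λ a b c d r →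
      a :* (((a :+ d) :- r) :- d) :+ b :* c
      := ((r :- d) :* lit 0 :+ (((a :+ d) :- r) :- d) :* ((a :+ d) :- r))
         :+ (:- lit 1) :* χ a b c d r) refl α β γ δ ρ)
    eigenvectors (suc zero) zero = solve 3 (λ c d r → c :* (r :- d) :+ d :* c := c :* r :+ c :* lit 0) refl γ δ ρ
    eigenvectors (suc zero) (suc zero) = solve 3 (λ c d r′ → c :* (r′ :- d) :+ d :* c := c :* lit 0 :+ c :* r′) refl γ δ ρ′

  -- Over an algebraically closed field a matrix with nonzero discriminant is
  -- diagonalizable; constructively we need to know whether M₁₀ vanishes.
  separable-diagonalizable : AlgClosed K → ∀ M → (M ₁ ₀ ≈ 0# ⊎ ¬ (M ₁ ₀ ≈ 0#)) →
    ¬ (discriminant M ≈ 0#) → Diagonalizable K M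
  separable-diagonalizable closed M (inj₂ γ≉0) Δ≉0 = lowerLeft-diagonalizable closed M γ≉0 Δ≉0
  separable-diagonalizable closed M (inj₁ γ≈0) Δ≉0 =
    triangular-diagonalizable M γ≈0 λ α-δ≈0 → Δ≉0 (begin
      discriminant M                    ≈⟨ solve 4 (λ a b c d →
        (a :+ d) :* (a :+ d) :- lit 4 :* (a :* d :- b :* c) := (a :- d) :* (a :- d) :+ c :* (lit 4 :* b)) refl α β γ δ ⟩
      (α - δ) * (α - δ) + γ * (nat 4 * β) ≈⟨ +-cong (trans (*-congʳ α-δ≈0) (zeroˡ _)) (trans (*-congʳ γ≈0) (zeroˡ _)) ⟩
      0# + 0#                           ≈⟨ +-identityʳ 0# ⟩
      0#                                ∎)
    where
    open ≈-Reasoning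
    α β γ δ : Carrier
    α = M ₀ ₀
    β = M ₀ ₁
    γ = M ₁ ₀
    δ = M ₁ ₁

  -- Conversely, a matrix with zero diagonal, det M ≠ 0 and 2 ≠ 0 has M₁₀ ≠ 0 and
  -- discriminant -4 det M ≠ 0.
  zeroDiagonal-diagonalizable⇐ : AlgClosed K → ∀ M → M ₀ ₀ ≈ 0# → M ₁ ₁ ≈ 0# →
    ¬ (det K M ≈ 0#) → ¬ (nat 2 ≈ 0#) → Diagonalizable K M
  zeroDiagonal-diagonalizable⇐ closed M α≈0 δ≈0 det≉0 2≉0 =
    lowerLeft-diagonalizable closed M γ≉0 Δ≉0
    where
    open ≈-Reasoning
    α β γ δ : Carrier
    α = M ₀ ₀
    β = M ₀ ₁
    γ = M ₁ ₀
    δ = M ₁ ₁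

    γ≉0 : ¬ (γ ≈ 0#)
    γ≉0 γ≈0 = det≉0 (begin
      α * δ - β * γ     ≈⟨ +-cong (*-congʳ α≈0) (-‿cong (*-congˡ γ≈0)) ⟩
      0# * δ - β * 0#   ≈⟨ solve 2 (λ b d → lit 0 :* d :- b :* lit 0 := lit 0) refl β δ ⟩
      0#                ∎)

    Δ≉0 : ¬ (discriminant M ≈ 0#)
    Δ≉0 Δ≈0 = *-nonzero 2≉0 (*-nonzero 2≉0 det≉0) (begin
      nat 2 * (nat 2 * det K M)                  ≈⟨ solve 4 (λ a b c d →
        lit 2 :* (lit 2 :* (a :* d :- b :* c))
        := (a :+ d) :* (a :+ d) :- ((a :+ d) :* (a :+ d) :- lit 4 :* (a :* d :- b :* c))) refl α β γ δ ⟩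
      trace M * trace M - discriminant M         ≈⟨ +-cong (*-cong tr≈0 tr≈0) (-‿cong Δ≈0) ⟩
      0# * 0# - 0#                               ≈⟨ solve 0 (lit 0 :* lit 0 :- lit 0 := lit 0) refl ⟩
      0#                                         ∎)
      where
      tr≈0 : trace M ≈ 0#
      tr≈0 = trans (+-cong α≈0 δ≈0) (+-identityʳ 0#)

  zeroDiagonal-criterion : AlgClosed K → ∀ M → M ₀ ₀ ≈ 0# → M ₁ ₁ ≈ 0# → ¬ (∀ a b → M a b ≈ 0#) →
    Diagonalizable K M ⇔ (¬ (det K M ≈ 0#) × ¬ (nat 2 ≈ 0#))
  zeroDiagonal-criterion closed M α≈0 δ≈0 M≉0 = mk⇔
    (zeroDiagonal-diagonalizable⇒ M α≈0 δ≈0 M≉0)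
    (λ (det≉0 , 2≉0) → zeroDiagonal-diagonalizable⇐ closed M α≈0 δ≈0 det≉0 2≉0)

module PrimePowers {p : ℕ} (p-prime : Prime p) where

  -- 2 is irreducible
  p∣2⇔p≡2 : p ∣ 2 ⇔ p ≡ 2
  p∣2⇔p≡2 = mk⇔ to (λ { ≡.refl → ∣-refl })
    where
    to : p ∣ 2 → p ≡ 2
    to p∣2 with irreducible[2] p∣2
    ... | inj₁ ≡.refl = ⊥-elim (¬prime[1] p-prime)
    ... | inj₂ p≡2 = p≡2

  -- 2 is prime, so 2 ∣ p^r forces 2 ∣ p, and p is prime
  2∣p^r⇔p≡2 : ∀ r → 1 ≤ r → 2 ∣ p ^ r ⇔ p ≡ 2
  2∣p^r⇔p≡2 r r≥1 = mk⇔ (2∣p⇒p≡2 ∘ 2∣power r) (λ { ≡.refl → 2∣2^r r r≥1 })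
    where
    2∣power : ∀ r → 2 ∣ p ^ r → 2 ∣ p
    2∣power zero 2∣1 with () ← ∣1⇒≡1 2∣1
    2∣power (suc r) 2∣pp^r with euclidsLemma p (p ^ r) prime[2] 2∣pp^r
    ... | inj₁ 2∣p = 2∣p
    ... | inj₂ 2∣p^r = 2∣power r 2∣p^r
    2∣p⇒p≡2 : 2 ∣ p → p ≡ 2
    2∣p⇒p≡2 2∣p with prime⇒irreducible p-prime 2∣p
    ... | inj₂ 2≡p = ≡.sym 2≡p
    2∣2^r : ∀ r → 1 ≤ r → 2 ∣ 2 ^ r
    2∣2^r (suc r) _ = m∣m*n (2 ^ r)

module Characteristic {c ℓ : Level} (K : CommutativeRing c ℓ) {p : ℕ} (p-prime : Prime p)
  (ιp≈0 : CommutativeRing._≈_ K (ι K p) (CommutativeRing.0# K))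
  (t : CommutativeRing.Carrier K) (transcendental : TranscendentalOverFp K p t) where
  open CommutativeRing K hiding (zero)
  open IntegerCoefficients K
  open import Algebra.Properties.Semiring.Mult.TCOptimised semiring using (1+×; ×-homo-+; ×1-homo-*)
  open import Algebra.Properties.Group +-group using (inverseʳ-unique)
  open import Relation.Binary.Reasoning.Setoid setoid

  -- ι is the solver's embedding of ℕ, hence a semiring homomorphism
  ι≈nat : ∀ n → ι K n ≈ nat n
  ι≈nat zero = refl
  ι≈nat (suc n) = trans (+-congˡ (ι≈nat n)) (sym (1+× n 1#))

  ι-+ : ∀ m n → ι K (m ℕ.+ n) ≈ ι K m + ι K n
  ι-+ m n = trans (ι≈nat (m ℕ.+ n)) (trans (×-homo-+ 1# m n) (sym (+-cong (ι≈nat m) (ι≈nat n))))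

  ι-* : ∀ m n → ι K (m ℕ.* n) ≈ ι K m * ι K n
  ι-* m n = trans (ι≈nat (m ℕ.* n)) (trans (×1-homo-* m n) (sym (*-cong (ι≈nat m) (ι≈nat n))))

  evalPoly-shift : ∀ m cs → evalPoly K (List.map (ι K) (replicate m 0 ++ cs)) t ≈ pow K t m * evalPoly K (List.map (ι K) cs) t
  evalPoly-shift zero cs = sym (*-identityˡ _)
  evalPoly-shift (suc m) cs = trans (+-identityˡ _) (trans (*-congˡ (evalPoly-shift m cs)) (sym (*-assoc _ _ _)))

  two-term≉0 : ∀ {a} → ¬ (p ∣ a) → ∀ m b → ¬ (ι K a + pow K t (suc m) * ι K b ≈ 0#)
  two-term≉0 {a} p∤a m b vanishes = transcendental (a ∷ replicate m 0 ++ b ∷ []) (here p∤a) (begin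
    ι K a + t * evalPoly K (List.map (ι K) (replicate m 0 ++ b ∷ [])) t
      ≈⟨ +-congˡ (*-congˡ (evalPoly-shift m (b ∷ []))) ⟩
    ι K a + t * (pow K t m * (ι K b + t * 0#))
      ≈⟨ +-congˡ (solve 3 (λ t u b → t :* (u :* (b :+ t :* lit 0)) := (t :* u) :* b) refl t (pow K t m) (ι K b)) ⟩
    ι K a + pow K t (suc m) * ι K b
      ≈⟨ vanishes ⟩
    0#                                                                 ∎)

  ι≈0⇔p∣ : ∀ m → ι K m ≈ 0# ⇔ p ∣ m
  ι≈0⇔p∣ m = mk⇔ to from
    where
    from : p ∣ m → ι K m ≈ 0#
    from (divides d ≡.refl) = trans (ι-* d p) (trans (*-congˡ ιp≈0) (zeroʳ _))
    to : ι K m ≈ 0# → p ∣ m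
    to ιm≈0 with p ∣? m
    ... | yes p∣m = p∣m
    ... | no p∤m = ⊥-elim (two-term≉0 p∤m 0 0 (trans (+-congˡ (zeroʳ _)) (trans (+-identityʳ _) ιm≈0)))

  -- t is a root of no nonzero polynomial, in particular not of X
  t≉0 : ¬ (t ≈ 0#)
  t≉0 t≈0 = transcendental (0 ∷ 1 ∷ []) (there (here p∤1))
    (trans (+-identityˡ _) (trans (*-congʳ t≈0) (zeroˡ _)))
    where
    p∤1 : ¬ (p ∣ 1)
    p∤1 p∣1 = ¬prime[1] (≡.subst Prime (∣1⇒≡1 p∣1) p-prime)

  -- ι (p - 1) = -1, so the signs (-1)^m are images of natural numbers
  ι-pred : ι K (p ∸ 1) ≈ - 1#
  ι-pred = inverseʳ-unique 1# (ι K (p ∸ 1)) (trans (reflexive (≡.cong (ι K) p≡1+[p-1])) ιp≈0)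
    where
    p≡1+[p-1] : suc (p ∸ 1) ≡ p
    p≡1+[p-1] = ℕP.suc-pred p {{prime⇒nonZero p-prime}}

  minus-one-power : ∀ m → pow K (- 1#) m ≈ ι K ((p ∸ 1) ^ m)
  minus-one-power zero = sym (+-identityʳ 1#)
  minus-one-power (suc m) = trans (*-cong (sym ι-pred) (minus-one-power m)) (sym (ι-* (p ∸ 1) ((p ∸ 1) ^ m)))

  open PrimePowers p-prime using (p∣2⇔p≡2; 2∣p^r⇔p≡2)
  open Equivalence

  q-even⇔two≈0 : ∀ {r q} → 1 ≤ r → q ≡ p ^ r → 2 ∣ q ⇔ nat 2 ≈ 0#
  q-even⇔two≈0 {r} r≥1 ≡.refl = mk⇔
    (λ 2∣q → trans (sym (ι≈nat 2)) (from (ι≈0⇔p∣ 2) (from p∣2⇔p≡2 (to (2∣p^r⇔p≡2 r r≥1) 2∣q))))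
    (λ 2≈0 → from (2∣p^r⇔p≡2 r r≥1) (to p∣2⇔p≡2 (to (ι≈0⇔p∣ 2) (trans (ι≈nat 2) 2≈0))))

-- The entries α β γ δ of M_j when C_j = {c_j, c_{j+(q-1)}}, i.e. when
-- j + (q-1) ≤ k - 2 < j + 2(q-1): δ vanishes, α and γ vanish or not according to
-- the divisibility by p of a natural number, and the discriminant is nonzero once
-- α is.
module CoefficientsOfMj {c ℓ : Level} (K : CommutativeRing c ℓ) (isField : IsField K)
  {p : ℕ} (p-prime : Prime p) (ιp≈0 : CommutativeRing._≈_ K (ι K p) (CommutativeRing.0# K))
  (t : CommutativeRing.Carrier K) (transcendental : TranscendentalOverFp K p t)
  (q k j : ℕ) (2≤k : 2 ≤ k)
  (lower : j ℕ.+ (q ∸ 1) ≤ k ∸ 2) (upper : k ∸ 2 < j ℕ.+ 2 ℕ.* (q ∸ 1)) where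
  open CommutativeRing K hiding (zero)
  open IntegerCoefficients K
  open Matrices K
  open Powers K
  open FieldArithmetic K isField
  open Diagonalization K isField
  open Characteristic K p-prime ιp≈0 t transcendental
  open import Algebra.Properties.Group +-group using (ε⁻¹≈ε; ⁻¹-injective)
  open import Relation.Binary.Reasoning.Setoid setoid

  n e b B₀ : ℕ
  n = k ∸ 2
  e = q ∸ 1
  b = j ℕ.+ e
  B₀ = (n ∸ j) C j

  M : Mat2 K
  M = Mj K q k t j

  e≥1 : 1 ≤ e
  e≥1 = positive e lower upper
    where
    positive : ∀ x → j ℕ.+ x ≤ n → n < j ℕ.+ 2 ℕ.* x → 1 ≤ x
    positive zero j≤n n<j = ⊥-elim (ℕP.<-irrefl ≡.refl (ℕP.≤-<-trans j≤n n<j))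
    positive (suc x) _ _ = s≤s z≤n

  -- (k - 2 - b choose b) = 0 because k - 2 - b < e ≤ b
  n-b<b : n ∸ b < b
  n-b<b = ℕP.<-≤-trans (ℕP.m<n+o⇒m∸n<o n b {{ℕ.>-nonZero e≥1}} n<b+e) (ℕP.m≤n+m e j)
    where
    j+2e≡b+e : j ℕ.+ 2 ℕ.* e ≡ b ℕ.+ e
    j+2e≡b+e = ≡.trans (≡.cong (λ z → j ℕ.+ (e ℕ.+ z)) (ℕP.+-identityʳ e)) (≡.sym (ℕP.+-assoc j e e))
    n<b+e : n < b ℕ.+ e
    n<b+e = ≡.subst (n <_) j+2e≡b+e upper

  diagonal-binomial : ∀ l → l ≤ n → binomℤ ((+ k ℤ.- + 2) ℤ.- + l) (+ l) ≡ (n ∸ l) C l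
  diagonal-binomial l l≤n = ≡.cong (λ z → binomℤ z (+ l))
    (≡.trans (≡.cong (ℤ._- + l) (difference k 2 2≤k)) (difference n l l≤n))
    where
    difference : ∀ x y → y ≤ x → + x ℤ.- + y ≡ + (x ∸ y)
    difference x y y≤x = ≡.trans (ℤP.m-n≡m⊖n x y) (ℤP.⊖-≥ y≤x)

  neg-times-zero : ∀ x {y} → y ≈ 0# → - (x * y) ≈ 0#
  neg-times-zero x y≈0 = trans (-‿cong (trans (*-congˡ y≈0) (zeroʳ x))) ε⁻¹≈ε

  δ≈0 : M ₁ ₁ ≈ 0#
  δ≈0 = neg-times-zero (pow K (- t) (suc b)) (reflexive (≡.cong (ι K)
    (≡.trans (diagonal-binomial b lower) (k>n⇒nCk≡0 n-b<b))))

  α≡ : M ₀ ₀ ≡ - (pow K (- t) (suc j) * ι K B₀)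
  α≡ = ≡.cong (λ z → - (pow K (- t) (suc j) * ι K z)) (diagonal-binomial j (ℕP.m+n≤o⇒m≤o j lower))

  α≈0 : p ∣ B₀ → M ₀ ₀ ≈ 0#
  α≈0 p∣B₀ = trans (reflexive α≡) (neg-times-zero _ (Equivalence.from (ι≈0⇔p∣ B₀) p∣B₀))

  offCoef-natural : ∀ l h → ∃ λ N → offCoef K q k t l h ≈ - (pow K t (suc l) * ι K N)
  offCoef-natural l h = X ℕ.+ (p ∸ 1) ℕ.^ suc l ℕ.* Y , -‿cong (*-congˡ (signed-sum (suc l) X Y))
    where
    N : ℤ
    N = ((+ k ℤ.- + 2) ℤ.- + l) ℤ.- h ℤ.* (+ q ℤ.- + 1)
    X Y : ℕ
    X = binomℤ N (ℤ.- (h ℤ.* (+ q ℤ.- + 1)))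
    Y = binomℤ N (+ l)
    signed-sum : ∀ m x y → ι K x + pow K (- 1#) m * ι K y ≈ ι K (x ℕ.+ (p ∸ 1) ℕ.^ m ℕ.* y)
    signed-sum m x y = begin
      ι K x + pow K (- 1#) m * ι K y             ≈⟨ +-congˡ (*-congʳ (minus-one-power m)) ⟩
      ι K x + ι K ((p ∸ 1) ℕ.^ m) * ι K y        ≈⟨ +-congˡ (ι-* ((p ∸ 1) ℕ.^ m) y) ⟨
      ι K x + ι K ((p ∸ 1) ℕ.^ m ℕ.* y)          ≈⟨ ι-+ x ((p ∸ 1) ℕ.^ m ℕ.* y) ⟨
      ι K (x ℕ.+ (p ∸ 1) ℕ.^ m ℕ.* y)            ∎

  T : Carrier
  T = pow K t (suc j)

  T≉0 : ¬ (T ≈ 0#)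
  T≉0 = pow-nonzero (suc j) t≉0

  -- γ = -T·N with N natural, so γ = 0 is decided by p ∣ N
  γ-decided : M ₁ ₀ ≈ 0# ⊎ ¬ (M ₁ ₀ ≈ 0#)
  γ-decided with offCoef-natural j (+ 1)
  ... | Nγ , γ≈ with p ∣? Nγ
  ...   | yes p∣Nγ = inj₁ (trans γ≈ (neg-times-zero T (Equivalence.from (ι≈0⇔p∣ Nγ) p∣Nγ)))
  ...   | no p∤Nγ = inj₂ λ γ≈0 → *-nonzero T≉0 (λ ιNγ≈0 → p∤Nγ (Equivalence.to (ι≈0⇔p∣ Nγ) ιNγ≈0))
                                   (⁻¹-injective (trans (sym γ≈) (trans γ≈0 (sym ε⁻¹≈ε))))

  -- Δ(M) = T²·(B₀² + κ t^e) for a natural number κ, which is nonzero by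
  -- transcendence of t as soon as p ∤ B₀
  discriminant≉0 : ¬ (p ∣ B₀) → ¬ (discriminant M ≈ 0#)
  discriminant≉0 p∤B₀ with offCoef-natural b (ℤ.- (+ 1)) | offCoef-natural j (+ 1)
  ... | Nβ , β≈ | Nγ , γ≈ = λ Δ≈0 →
    *-nonzero (*-nonzero T≉0 T≉0) (two-term≉0 p∤B₀² e′ κ) (trans (sym factorization) Δ≈0)
    where
    e′ κ : ℕ
    e′ = e ∸ 1
    κ = 4 ℕ.* Nβ ℕ.* Nγ
    A U : Carrier
    A = pow K (- t) (suc j)
    U = pow K t (suc e′)

    p∤B₀² : ¬ (p ∣ B₀ ℕ.* B₀)
    p∤B₀² p∣B₀² with euclidsLemma B₀ B₀ p-prime p∣B₀²
    ... | inj₁ p∣B₀ = p∤B₀ p∣B₀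
    ... | inj₂ p∣B₀ = p∤B₀ p∣B₀

    t^[b+1]≈UT : pow K t (suc b) ≈ U * T
    t^[b+1]≈UT = trans (reflexive (≡.cong (pow K t) b+1≡[e′+1]+[j+1])) (pow-+ t (suc e′) (suc j))
      where
      b+1≡[e′+1]+[j+1] : suc b ≡ suc e′ ℕ.+ suc j
      b+1≡[e′+1]+[j+1] = ≡.trans (≡.cong suc (ℕP.+-comm j e))
        (≡.trans (≡.sym (ℕP.+-suc e j)) (≡.cong (ℕ._+ suc j) (≡.sym (ℕP.suc-pred e {{ℕ.>-nonZero e≥1}}))))

    N : Mat2 K
    N = mk (- (A * ι K B₀)) (- ((U * T) * ι K Nβ)) (- (T * ι K Nγ)) 0#

    M≋N : M ≋ N
    M≋N zero zero = reflexive α≡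
    M≋N zero (suc zero) = trans β≈ (-‿cong (*-congʳ t^[b+1]≈UT))
    M≋N (suc zero) zero = γ≈
    M≋N (suc zero) (suc zero) = δ≈0

    κ-image : nat 4 * ι K Nβ * ι K Nγ ≈ ι K κ
    κ-image = sym (trans (ι-* (4 ℕ.* Nβ) Nγ) (*-congʳ (trans (ι-* 4 Nβ) (*-congʳ (ι≈nat 4)))))

    factorization : discriminant M ≈ (T * T) * (ι K (B₀ ℕ.* B₀) + U * ι K κ)
    factorization = begin
      discriminant M                                   ≈⟨ discriminant-cong M≋N ⟩
      discriminant N                                   ≈⟨ solve 6 (λ A iB U T nβ nγ →
         (:- (A :* iB) :+ lit 0) :* (:- (A :* iB) :+ lit 0)
           :- lit 4 :* ((:- (A :* iB)) :* lit 0 :- (:- ((U :* T) :* nβ)) :* (:- (T :* nγ)))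
         := (A :* A) :* (iB :* iB) :+ (T :* T) :* (U :* (lit 4 :* nβ :* nγ)))
         refl A (ι K B₀) U T (ι K Nβ) (ι K Nγ) ⟩
      (A * A) * (ι K B₀ * ι K B₀) + (T * T) * (U * (nat 4 * ι K Nβ * ι K Nγ))
        ≈⟨ +-cong (*-cong (pow-neg-square t (suc j)) (sym (ι-* B₀ B₀)))
                  (*-congˡ (*-congˡ κ-image)) ⟩
      (T * T) * ι K (B₀ ℕ.* B₀) + (T * T) * (U * ι K κ) ≈⟨ distribˡ (T * T) _ _ ⟨
      (T * T) * (ι K (B₀ ℕ.* B₀) + U * ι K κ)           ∎

-- natural-number + and * unqualified only here: above they would clash with
-- the ring operations
open import Data.Nat using (_+_; _*_)

lemma4p1 : {c ℓ : Level} (K : CommutativeRing c ℓ) →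
  IsField K → AlgClosed K →
  (p r q : ℕ) → Prime p → 1 ≤ r → q ≡ p ^ r →
  CommutativeRing._≈_ K (ι K p) (CommutativeRing.0# K) →
  (t : CommutativeRing.Carrier K) → TranscendentalOverFp K p t →
  (k j : ℕ) → 2 ≤ k → j ≤ q ∸ 2 →
  j + (q ∸ 1) ≤ k ∸ 2 → k ∸ 2 < j + 2 * (q ∸ 1) →
  ¬ (∀ (a b : Fin 2) → CommutativeRing._≈_ K (Mj K q k t j a b) (CommutativeRing.0# K)) →
  Diagonalizable K (Mj K q k t j) ⇔
    ((¬ (p ∣ ((k ∸ 2 ∸ j) C j)))
     ⊎ ((¬ (2 ∣ q)) × ¬ (CommutativeRing._≈_ K (det K (Mj K q k t j)) (CommutativeRing.0# K))))
lemma4p1 {ℓ = ℓ} K isField closed p r q p-prime r≥1 q≡p^r ιp≈0 t transcendental k j 2≤k _ lower upper M≉0 =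
  mk⇔ forward backward
  where
  open CommutativeRing K using (_≈_; 0#)
  open IntegerCoefficients K using (nat)
  open Diagonalization K isField
  open Characteristic K p-prime ιp≈0 t transcendental using (q-even⇔two≈0)
  open CoefficientsOfMj K isField p-prime ιp≈0 t transcendental q k j 2≤k lower upper
  open Equivalence

  Condition : Set ℓ
  Condition = (¬ (p ∣ B₀)) ⊎ ((¬ (2 ∣ q)) × ¬ (det K M ≈ 0#))

  parity : 2 ∣ q ⇔ nat 2 ≈ 0#
  parity = q-even⇔two≈0 r≥1 q≡p^r

  -- if p ∣ B₀ then α = δ = 0 and the zero-diagonal criterion yields the second alternative
  forward : Diagonalizable K M → Condition
  forward diagonalizable with p ∣? B₀
  ... | no p∤B₀ = inj₁ p∤B₀
  ... | yes p∣B₀ =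
    let det≉0 , 2≉0 = to (zeroDiagonal-criterion closed M (α≈0 p∣B₀) δ≈0 M≉0) diagonalizable
    in inj₂ ((λ 2∣q → 2≉0 (to parity 2∣q)) , det≉0)

  -- if p ∤ B₀ the discriminant is nonzero; otherwise the zero-diagonal criterion applies
  backward : Condition → Diagonalizable K M
  backward condition with p ∣? B₀
  ... | no p∤B₀ = separable-diagonalizable closed M γ-decided (discriminant≉0 p∤B₀)
  backward (inj₁ p∤B₀) | yes p∣B₀ = ⊥-elim (p∤B₀ p∣B₀)
  backward (inj₂ (q-odd , det≉0)) | yes p∣B₀ =
    from (zeroDiagonal-criterion closed M (α≈0 p∣B₀) δ≈0 M≉0) (det≉0 , λ 2≈0 → q-odd (from parity 2≈0))
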